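{- Let $\mathcal{G}$ and $\mathcal{H}$ be two hypergraphs on vertex set $V$, and let $T$ be a new minimal transversal of $\mathcal{G}$ with respect to $\mathcal{H}$. If $\sigma$ is a saturated precursor of $T$, then $\sigma^+=\langle T,V\setminus T\rangle$, and thus $\sigma^+$ is a double witness.
   Context: Hypergraphs are identified with their edge sets over the common vertex set $V$. Transversal: meets every edge; minimal transversal: no proper subset is a transversal; independent set of $\mathcal{H}$: contains no edge of $\mathcal{H}$; new transversal of $\mathcal{G}$ w.r.t. $\mathcal{H}$: transversal of $\mathcal{G}$ that is independent in $\mathcal{H}$; new minimal transversal: a new transversal that is a minimal transversal of $\mathcal{G}$. Assignment: pair $\sigma=\langle\mathrm{In},\mathrm{Ex}\rangle$ of disjoint subsets of $V$; free vertices: those not in $\mathrm{In}\cup\mathrm{Ex}$; coherent with $S$: $\mathrm{In}\subseteq S$, $\mathrm{Ex}\cap S=\emptyset$. $\mathrm{Com}(\sigma)=\{H\in\mathcal{H}:H\cap\mathrm{Ex}=\emptyset\}$. A free vertex is frequent if it belongs to at least half of the edges of $\mathrm{Com}(\sigma)$, infrequent otherwise; $\sigma^+=\langle\mathrm{In}\cup\mathrm{Freq}(\sigma),\mathrm{Ex}\cup\mathrm{Infreq}(\sigma)\rangle$. Witness: $\mathrm{In}$ is a new transversal of $\mathcal{G}$ w.r.t. $\mathcal{H}$ or $\mathrm{Ex}$ is a new transversal of $\mathcal{H}$ w.r.t. $\mathcal{G}$; double witness: both hold. Precursor of $T$: coherent with $T$ and not a witness. A free vertex $v$ is appealing to exclude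 (w.r.t. $T$) if $v$ is frequent and $v\notin T$; appealing to include if $v$ is infrequent and $v\in T$. A saturated precursor of $T$ is a precursor of $T$ with no free vertex appealing to exclude or include w.r.t. $T$. -}

module Defs where

open import Data.Nat using (ℕ; _≤_; _*_; _≤?_)
open import Data.Bool using (Bool)
open import Data.Fin using (Fin)
open import Data.Fin.Subset using (Subset; _∈_; _∉_; _⊆_; _⊂_; _∩_; _∪_; ∁; Nonempty; Empty)
open import Data.Fin.Subset.Properties using (_∈?_; nonempty?)
open import Data.List using (List; length; filter)
open import Data.List.Relation.Unary.All using (All)
open import Data.Product using (_×_; _,_)
open import Data.Sum using (_⊎_)
open import Data.Vec using (tabulate)
open import Relation.Nullary using (¬_; Dec; does; ¬?)
open import Relation.Nullary.Decidable using (_×-dec_)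

Hypergraph : ℕ → Set
Hypergraph n = List (Subset n)

module _ {n : ℕ} where

  Transversal : Hypergraph n → Subset n → Set
  Transversal G S = All (λ E → Nonempty (E ∩ S)) G

  MinimalTransversal : Hypergraph n → Subset n → Set
  MinimalTransversal G S = Transversal G S × (∀ S′ → S′ ⊂ S → ¬ Transversal G S′)

  Independent : Hypergraph n → Subset n → Set
  Independent H S = All (λ E → ¬ (E ⊆ S)) H

  NewTransversal : Hypergraph n → Hypergraph n → Subset n → Set
  NewTransversal G H S = Transversal G S × Independent H S

  NewMinimalTransversal : Hypergraph n → Hypergraph n → Subset n → Set
  NewMinimalTransversal G H S = NewTransversal G H S × MinimalTransversal G S

  record Assignment : Set where
    constructor ⟨_,_∣_⟩
    field
      In       : Subset n
      Ex       : Subset n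
      disjoint : Empty (In ∩ Ex)
  open Assignment public

  Free : Assignment → Fin n → Set
  Free σ v = v ∉ In σ × v ∉ Ex σ

  free? : (σ : Assignment) (v : Fin n) → Dec (Free σ v)
  free? σ v = ¬? (v ∈? In σ) ×-dec ¬? (v ∈? Ex σ)

  Coherent : Assignment → Subset n → Set
  Coherent σ S = In σ ⊆ S × Empty (Ex σ ∩ S)

  Com : Hypergraph n → Assignment → Hypergraph n
  Com H σ = filter (λ E → ¬? (nonempty? (E ∩ Ex σ))) H

  degCom : Hypergraph n → Assignment → Fin n → ℕ
  degCom H σ v = length (filter (λ E → v ∈? E) (Com H σ))

  Frequent : Hypergraph n → Assignment → Fin n → Set
  Frequent H σ v = Free σ v × length (Com H σ) ≤ 2 * degCom H σ v

  Infrequent : Hypergraph n → Assignment → Fin n → Set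
  Infrequent H σ v = Free σ v × ¬ (length (Com H σ) ≤ 2 * degCom H σ v)

  frequent? : (H : Hypergraph n) (σ : Assignment) (v : Fin n) → Dec (Frequent H σ v)
  frequent? H σ v = free? σ v ×-dec (length (Com H σ) ≤? 2 * degCom H σ v)

  infrequent? : (H : Hypergraph n) (σ : Assignment) (v : Fin n) → Dec (Infrequent H σ v)
  infrequent? H σ v = free? σ v ×-dec ¬? (length (Com H σ) ≤? 2 * degCom H σ v)

  Freq : Hypergraph n → Assignment → Subset n
  Freq H σ = tabulate (λ v → does (frequent? H σ v))

  Infreq : Hypergraph n → Assignment → Subset n
  Infreq H σ = tabulate (λ v → does (infrequent? H σ v))

  plus : Hypergraph n → Assignment → Subset n × Subset n
  plus H σ = (In σ ∪ Freq H σ , Ex σ ∪ Infreq H σ)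

  WitnessPair : Hypergraph n → Hypergraph n → Subset n × Subset n → Set
  WitnessPair G H (I , X) = NewTransversal G H I ⊎ NewTransversal H G X

  DoubleWitnessPair : Hypergraph n → Hypergraph n → Subset n × Subset n → Set
  DoubleWitnessPair G H (I , X) = NewTransversal G H I × NewTransversal H G X

  Witness : Hypergraph n → Hypergraph n → Assignment → Set
  Witness G H σ = WitnessPair G H (In σ , Ex σ)

  Precursor : Hypergraph n → Hypergraph n → Subset n → Assignment → Set
  Precursor G H T σ = Coherent σ T × ¬ Witness G H σ

  AppealingToExclude : Hypergraph n → Subset n → Assignment → Fin n → Set
  AppealingToExclude H T σ v = Frequent H σ v × v ∉ T

  AppealingToInclude : Hypergraph n → Subset n → Assignment → Fin n → Set
  AppealingToInclude H T σ v = Infrequent H σ v × v ∈ T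

  SaturatedPrecursor : Hypergraph n → Hypergraph n → Subset n → Assignment → Set
  SaturatedPrecursor G H T σ =
    Precursor G H T σ ×
    (∀ v → ¬ AppealingToExclude H T σ v × ¬ AppealingToInclude H T σ v)

-- Coherence puts In inside T and Ex outside T, and every free vertex is either
-- frequent or infrequent.  Saturation forbids a frequent vertex outside T and an
-- infrequent one inside T, so σ⁺ includes exactly T and excludes exactly V ∖ T.
-- The double witness then comes from complementation: a set contains no edge of a
-- hypergraph iff its complement meets every edge, so the complement of a new
-- transversal of G w.r.t. H is a new transversal of H w.r.t. G.
module Submission where

open import Defs
open import Data.Nat using (ℕ)
open import Data.Fin using (Fin)
open import Data.Fin.Subset using (Subset; ∁; _∈_; _∉_; _⊆_; _∩_; _∪_; Nonempty)
open import Data.Fin.Subset.Properties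
  using (_∈?_; nonempty?; ⊆-antisym; x∈p∪q⁺; x∈p∪q⁻; x∈p∩q⁺; x∈p∩q⁻; x∉p⇒x∈∁p; x∈∁p⇒x∉p; x∉∁p⇒x∈p; x∈p⇒x∉∁p)
open import Data.List.Relation.Unary.All as All using ()
open import Data.Product using (_×_; _,_; proj₁; proj₂)
open import Data.Sum using (_⊎_; inj₁; inj₂)
open import Data.Vec using (tabulate)
open import Data.Vec.Properties using ([]=⇒lookup; lookup⇒[]=; lookup∘tabulate)
open import Relation.Nullary using (Dec; yes; no; does; ¬_; contradiction)
open import Relation.Nullary.Decidable using (dec-true)
open import Relation.Binary.PropositionalEquality using (_≡_; sym; trans; subst; cong₂)

module _ {n : ℕ} where

  ∈-tabulate-does⁺ : {P : Fin n → Set} (P? : ∀ v → Dec (P v)) {v : Fin n} →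
                     P v → v ∈ tabulate (λ w → does (P? w))
  ∈-tabulate-does⁺ P? {v} p =
    lookup⇒[]= v _ (trans (lookup∘tabulate (λ w → does (P? w)) v) (dec-true (P? v) p))

  ∈-tabulate-does⁻ : {P : Fin n → Set} (P? : ∀ v → Dec (P v)) {v : Fin n} →
                     v ∈ tabulate (λ w → does (P? w)) → P v
  ∈-tabulate-does⁻ P? {v} v∈ with P? v | trans (sym (lookup∘tabulate (λ w → does (P? w)) v)) ([]=⇒lookup v∈)
  ... | yes p | _ = p
  ... | no _  | ()

  ⊈⇒∩∁-nonempty : (E S : Subset n) → ¬ (E ⊆ S) → Nonempty (E ∩ ∁ S)
  ⊈⇒∩∁-nonempty E S E⊈S with nonempty? (E ∩ ∁ S)
  ... | yes ne    = ne
  ... | no  empty = contradiction (λ {v} → E⊆S {v}) E⊈S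
    where
    E⊆S : E ⊆ S
    E⊆S v∈E = x∉∁p⇒x∈p (λ v∈∁S → empty (_ , x∈p∩q⁺ (v∈E , v∈∁S)))

  ∩-nonempty⇒⊈∁ : (E S : Subset n) → Nonempty (E ∩ S) → ¬ (E ⊆ ∁ S)
  ∩-nonempty⇒⊈∁ E S (v , v∈E∩S) E⊆∁S =
    let v∈E , v∈S = x∈p∩q⁻ E S v∈E∩S in x∈p⇒x∉∁p v∈S (E⊆∁S v∈E)

  independent⇒∁-transversal : (H : Hypergraph n) (S : Subset n) →
                              Independent H S → Transversal H (∁ S)
  independent⇒∁-transversal H S = All.map (λ {E} → ⊈⇒∩∁-nonempty E S)

  transversal⇒∁-independent : (G : Hypergraph n) (S : Subset n) →
                              Transversal G S → Independent G (∁ S)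
  transversal⇒∁-independent G S = All.map (λ {E} → ∩-nonempty⇒⊈∁ E S)

  ∁-newTransversal : (G H : Hypergraph n) (S : Subset n) →
                     NewTransversal G H S → NewTransversal H G (∁ S)
  ∁-newTransversal G H S (trG , indH) =
    independent⇒∁-transversal H S indH , transversal⇒∁-independent G S trG

  classify : (H : Hypergraph n) (σ : Assignment) (v : Fin n) →
             v ∈ In σ ⊎ v ∈ Ex σ ⊎ Frequent H σ v ⊎ Infrequent H σ v
  classify H σ v with v ∈? In σ | v ∈? Ex σ | frequent? H σ v
  ... | yes v∈In | _        | _      = inj₁ v∈In
  ... | no _     | yes v∈Ex | _      = inj₂ (inj₁ v∈Ex)
  ... | no _     | no _     | yes fr = inj₂ (inj₂ (inj₁ fr))
  ... | no v∉In  | no v∉Ex  | no ¬fr =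
    inj₂ (inj₂ (inj₂ ((v∉In , v∉Ex) , λ half → ¬fr ((v∉In , v∉Ex) , half))))

  module Saturated (H : Hypergraph n) (T : Subset n) (σ : Assignment)
                   (coherent : Coherent σ T)
                   (unappealing : ∀ v → ¬ AppealingToExclude H T σ v × ¬ AppealingToInclude H T σ v)
                   where

    In⊆T : In σ ⊆ T
    In⊆T = proj₁ coherent

    Ex∌T : ∀ {v} → v ∈ Ex σ → v ∉ T
    Ex∌T v∈Ex v∈T = proj₂ coherent (_ , x∈p∩q⁺ (v∈Ex , v∈T))

    frequent⇒∈T : ∀ {v} → Frequent H σ v → v ∈ T
    frequent⇒∈T {v} fr with v ∈? T
    ... | yes v∈T = v∈T
    ... | no  v∉T = contradiction (fr , v∉T) (proj₁ (unappealing v))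

    infrequent⇒∉T : ∀ {v} → Infrequent H σ v → v ∉ T
    infrequent⇒∉T {v} inf v∈T = proj₂ (unappealing v) (inf , v∈T)

    included≡T : In σ ∪ Freq H σ ≡ T
    included≡T = ⊆-antisym included⊆T T⊆included
      where
      included⊆T : In σ ∪ Freq H σ ⊆ T
      included⊆T v∈ with x∈p∪q⁻ (In σ) _ v∈
      ... | inj₁ v∈In   = In⊆T v∈In
      ... | inj₂ v∈Freq = frequent⇒∈T (∈-tabulate-does⁻ (frequent? H σ) v∈Freq)

      T⊆included : T ⊆ In σ ∪ Freq H σ
      T⊆included {v} v∈T with classify H σ v
      ... | inj₁ v∈In                = x∈p∪q⁺ (inj₁ v∈In)
      ... | inj₂ (inj₁ v∈Ex)         = contradiction v∈T (Ex∌T v∈Ex)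
      ... | inj₂ (inj₂ (inj₁ fr))    = x∈p∪q⁺ (inj₂ (∈-tabulate-does⁺ (frequent? H σ) fr))
      ... | inj₂ (inj₂ (inj₂ inf))   = contradiction v∈T (infrequent⇒∉T inf)

    excluded≡∁T : Ex σ ∪ Infreq H σ ≡ ∁ T
    excluded≡∁T = ⊆-antisym excluded⊆∁T ∁T⊆excluded
      where
      excluded⊆∁T : Ex σ ∪ Infreq H σ ⊆ ∁ T
      excluded⊆∁T v∈ with x∈p∪q⁻ (Ex σ) _ v∈
      ... | inj₁ v∈Ex     = x∉p⇒x∈∁p (Ex∌T v∈Ex)
      ... | inj₂ v∈Infreq = x∉p⇒x∈∁p (infrequent⇒∉T (∈-tabulate-does⁻ (infrequent? H σ) v∈Infreq))

      ∁T⊆excluded : ∁ T ⊆ Ex σ ∪ Infreq H σ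
      ∁T⊆excluded {v} v∈∁T with classify H σ v
      ... | inj₁ v∈In                = contradiction (In⊆T v∈In) (x∈∁p⇒x∉p v∈∁T)
      ... | inj₂ (inj₁ v∈Ex)         = x∈p∪q⁺ (inj₁ v∈Ex)
      ... | inj₂ (inj₂ (inj₁ fr))    = contradiction (frequent⇒∈T fr) (x∈∁p⇒x∉p v∈∁T)
      ... | inj₂ (inj₂ (inj₂ inf))   = x∈p∪q⁺ (inj₂ (∈-tabulate-does⁺ (infrequent? H σ) inf))

    plus≡⟨T,∁T⟩ : plus H σ ≡ (T , ∁ T)
    plus≡⟨T,∁T⟩ = cong₂ _,_ included≡T excluded≡∁T

lemma9 : {n : ℕ} (G H : Hypergraph n) (T : Subset n) (σ : Assignment) →
    NewMinimalTransversal G H T →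
    SaturatedPrecursor G H T σ →
    plus H σ ≡ (T , ∁ T) × DoubleWitnessPair G H (plus H σ)
lemma9 G H T σ (newT , _) ((coherent , _) , unappealing) =
  plus≡⟨T,∁T⟩ , subst (DoubleWitnessPair G H) (sym plus≡⟨T,∁T⟩) (newT , ∁-newTransversal G H T newT)
  where open Saturated H T σ coherent unappealing
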